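{- Let $M$ be a system execution for the Lazy Set language satisfying the axioms A0, A1 and A2. For every event $x$ with $\mathrm{Op}^1(x)$ there is no event $y$ with $\mathrm{Op}^0(y)$ such that $\mathrm{val}(y)=\mathrm{val}(x)$ and $\gamma(x)<y<x$.
   Context: A structure $M$ for the Lazy Set language has a set of events, each low-level (an "action") or high-level; unary predicates $\mathrm{Add},\mathrm{Rem},\mathrm{Cnt}$ on events; a binary relation $<$ on events; functions $\mathrm{Begin},\mathrm{End}$ from events to events, $\chi$ from events to $\{0,1,f\}$, $\mathrm{val}$ from events to $\mathbb N$, $\gamma$ from events to events. $M$ is a system execution if $<$ is a strict partial order on the events such that for every event $x$ there is a finite set $E$ with $x<y$ for all $y\notin E$; $\mathrm{Begin}(e)=\mathrm{End}(e)=e$ for low-level $e$; and $X<Y$ iff $\mathrm{End}(X)<\mathrm{Begin}(Y)$. Shorthands: $\mathrm{Add}^p(a):\equiv\mathrm{Add}(a)\wedge\chi(a)=p$, similarly $\mathrm{Rem}^p,\mathrm{Cnt}^p$; $\mathrm{Op}^p(a):\equiv(\mathrm{Add}(a)\vee\mathrm{Rem}(a)\vee\mathrm{Cnt}(a))\wedge\chi(a)=p$ for $p\in\{0,1\}$. A0: $\mathrm{Add},\mathrm{Rem},\mathrm{Cnt}$ pairwise disjoint; Add and Rem events low-level, Cnt events high-level; $\mathrm{Begin}(X),\mathrm{End}(X)$ low-level for all $X$; $\mathrm{Begin}(E)=\mathrm{End}(E)=E$ for Add/Rem events, $\mathrm{Begin}(E)<\mathrm{End}(E)$ for Cnt events;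 $<$ is linear on low-level events. A1: for every $A$ with $\mathrm{Op}^1(A)$: $\mathrm{Add}^0(\gamma(A))$, $\mathrm{val}(\gamma(A))=\mathrm{val}(A)$, $\gamma(A)<\mathrm{End}(A)$, and there is no $R$ with $\mathrm{Rem}^1(R)$, $\gamma(R)=\gamma(A)$, $\gamma(A)<R<A$. A2: for all $A,B$: if $\mathrm{Op}^0(B)$, $\mathrm{Add}^0(A)$, $A<B$, $\mathrm{val}(A)=\mathrm{val}(B)$, then there is $R$ with $\mathrm{Rem}^1(R)$, $A=\gamma(R)$, $R<\mathrm{End}(B)$. -}

module Defs where

open import Level using (Level; suc; _⊔_)
open import Data.Nat using (ℕ)
open import Data.Product using (Σ; _×_; ∃; ∃-syntax)
open import Data.Sum using (_⊎_)
open import Data.List using (List)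
open import Data.Empty using (⊥)
open import Data.List.Membership.Propositional using (_∈_)
open import Relation.Nullary using (¬_)
open import Relation.Binary.PropositionalEquality using (_≡_)
open import Relation.Binary.Definitions using (Irreflexive; Transitive)

data ChiVal : Set where
  c0 c1 cf : ChiVal

record LazySetStructure : Set₁ where
  field
    Event   : Set
    Low     : Event → Set
    Add Rem Cnt : Event → Set
    _<_     : Event → Event → Set
    Begin End : Event → Event
    χ       : Event → ChiVal
    val     : Event → ℕ
    γ       : Event → Event

module _ (M : LazySetStructure) where
  open LazySetStructure M

  Add^ Rem^ Cnt^ : ChiVal → Event → Set
  Add^ p a = Add a × χ a ≡ p
  Rem^ p a = Rem a × χ a ≡ p
  Cnt^ p a = Cnt a × χ a ≡ p

  Op^ : ChiVal → Event → Set
  Op^ p a = (Add a ⊎ Rem a ⊎ Cnt a) × χ a ≡ p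

  record IsSystemExecution : Set where
    field
      <-irrefl : ∀ x → ¬ (x < x)
      <-trans  : ∀ {x y z} → x < y → y < z → x < z
      <-finite : ∀ x → ∃[ L ] (∀ y → ¬ (y ∈ L) → x < y)
      low-Begin : ∀ e → Low e → Begin e ≡ e
      low-End   : ∀ e → Low e → End e ≡ e
      <-End-Begin : ∀ X Y → (X < Y → End X < Begin Y) × (End X < Begin Y → X < Y)

  record A0 : Set where
    field
      disj-AR : ∀ e → Add e → Rem e → ⊥
      disj-AC : ∀ e → Add e → Cnt e → ⊥
      disj-RC : ∀ e → Rem e → Cnt e → ⊥
      add-low  : ∀ e → Add e → Low e
      rem-low  : ∀ e → Rem e → Low e
      cnt-high : ∀ e → Cnt e → ¬ Low e
      begin-low : ∀ X → Low (Begin X)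
      end-low   : ∀ X → Low (End X)
      add-Begin : ∀ e → Add e → Begin e ≡ e
      add-End   : ∀ e → Add e → End e ≡ e
      rem-Begin : ∀ e → Rem e → Begin e ≡ e
      rem-End   : ∀ e → Rem e → End e ≡ e
      cnt-Begin<End : ∀ e → Cnt e → Begin e < End e
      low-linear : ∀ a b → Low a → Low b → a < b ⊎ a ≡ b ⊎ b < a

  record A1 : Set where
    field
      a1 : ∀ A → Op^ c1 A →
             Add^ c0 (γ A) × val (γ A) ≡ val A × γ A < End A ×
             ¬ (∃[ R ] (Rem^ c1 R × γ R ≡ γ A × γ A < R × R < A))

  record A2 : Set where
    field
      a2 : ∀ A B → Op^ c0 B → Add^ c0 A → A < B → val A ≡ val B →
             ∃[ R ] (Rem^ c1 R × A ≡ γ R × R < End B)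

-- By A2 the add γ x < y must have been removed before y ended, by some Rem¹
-- event R with γ R = γ x.  A1 puts γ R before the instantaneous R, and
-- R < End y < Begin x, so R lies strictly between γ x and x: A1 for x forbids it.
module Submission where

open import Defs
open import Data.Product using (_×_; ∃-syntax; _,_; proj₁; proj₂)
open import Data.Sum using (inj₁; inj₂)
open import Relation.Nullary using (¬_)
open import Relation.Binary.PropositionalEquality using (_≡_; subst; sym; trans)

module _ {M : LazySetStructure} where
  open LazySetStructure M

  Rem^⇒Op^ : ∀ {p R} → Rem^ M p R → Op^ M p R
  Rem^⇒Op^ (rem , χR≡p) = inj₂ (inj₁ rem) , χR≡p

  γ-Rem¹< : A0 M → A1 M → ∀ {R} → Rem^ M c1 R → γ R < R
  γ-Rem¹< a0 ax1 {R} rem¹@(rem , _) with A1.a1 ax1 R (Rem^⇒Op^ rem¹)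
  ... | _ , _ , γR<EndR , _ = subst (γ R <_) (A0.rem-End a0 R rem) γR<EndR

  <-End-trans : IsSystemExecution M → ∀ {e X Y} → End e ≡ e → e < End X → X < Y → e < Y
  <-End-trans se {e} {X} {Y} End-e e<EndX X<Y =
    proj₂ (<-End-Begin e Y) (subst (_< Begin Y) (sym End-e) (<-trans e<EndX EndX<BeginY))
    where
    open IsSystemExecution se
    EndX<BeginY : End X < Begin Y
    EndX<BeginY = proj₁ (<-End-Begin X Y) X<Y

lemma3p4 : (M : LazySetStructure) → IsSystemExecution M → A0 M → A1 M → A2 M →
    let open LazySetStructure M in
    ∀ x → Op^ M c1 x →
    ¬ (∃[ y ] (Op^ M c0 y × val y ≡ val x × γ x < y × y < x))
lemma3p4 M se a0 ax1 ax2 x op¹x (y , op⁰y , vy≡vx , γx<y , y<x)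
  with A1.a1 ax1 x op¹x
... | add⁰γx , vγx≡vx , _ , no-Rem¹-between
  with A2.a2 ax2 (LazySetStructure.γ M x) y op⁰y add⁰γx γx<y (trans vγx≡vx (sym vy≡vx))
... | R , rem¹@(rem , _) , γx≡γR , R<Endy =
  no-Rem¹-between (R , rem¹ , sym γx≡γR , γx<R , R<x)
  where
  open LazySetStructure M
  γx<R : γ x < R
  γx<R = subst (_< R) (sym γx≡γR) (γ-Rem¹< a0 ax1 rem¹)
  R<x : R < x
  R<x = <-End-trans se (A0.rem-End a0 R rem) R<Endy y<x
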